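{- Let $G$ be a bridgeless connected subcubic graph. Let $V_0\subseteq V(G)$, and let $N$ denote the set of vertices not in $V_0$ that have a neighbour in $V_0$. Let $(N,E^*)$ be a graph on vertex set $N$ each of whose components is either a single vertex or has at least three vertices. Suppose there is at least one edge of $E^*$ which is not an edge of $G$. Then there exists $e\in E^*$ with $e \notin E(G)$ such that the graph $G-V_0+e$ (obtained from $G$ by deleting $V_0$ and adding the edge $e$) is subcubic and has no cubic component.
   Context: All graphs are finite, undirected and simple. A graph is subcubic if its maximum degree is at most $3$, and cubic if it is $3$-regular. A bridge is an edge whose removal increases the number of connected components; a graph is bridgeless if it has no bridge. -}

module Defs where

open import Data.Nat using (ℕ; _≤_)
open import Data.Bool using (Bool; true; false; _∧_; _∨_; not)
open import Data.Fin using (Fin; _≟_)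
open import Data.Fin.Subset using (∣_∣)
open import Data.Vec using (tabulate)
open import Data.Product using (Σ; _×_; ∃; ∃-syntax)
open import Data.Sum using (_⊎_)
open import Relation.Nullary using (¬_; ⌊_⌋)
open import Relation.Binary.PropositionalEquality using (_≡_)

-- A (possibly not simple-checked) graph whose vertex set is a subset of Fin n:
-- 'vert v' says whether v is a vertex, 'adj u v' whether uv is an edge.
record RawGraph (n : ℕ) : Set where
  constructor mkRaw
  field
    vert : Fin n → Bool
    adj  : Fin n → Fin n → Bool
open RawGraph public

record Graph (n : ℕ) : Set where
  field
    raw     : RawGraph n
    sym     : ∀ u v → adj raw u v ≡ adj raw v u
    irrefl  : ∀ v → adj raw v v ≡ false
    adj-vert : ∀ u v → adj raw u v ≡ true → vert raw u ≡ true
open Graph public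

V : ∀ {n} → Graph n → Fin n → Bool
V G = vert (raw G)

E : ∀ {n} → Graph n → Fin n → Fin n → Bool
E G = adj (raw G)

deg : ∀ {n} → RawGraph n → Fin n → ℕ
deg R v = ∣ tabulate (adj R v) ∣

Subcubic : ∀ {n} → RawGraph n → Set
Subcubic R = ∀ v → vert R v ≡ true → deg R v ≤ 3

data Reach {n} (R : RawGraph n) : Fin n → Fin n → Set where
  here : ∀ {v} → Reach R v v
  step : ∀ {u w v} → adj R u w ≡ true → Reach R w v → Reach R u v

Connected : ∀ {n} → RawGraph n → Set
Connected R = ∀ u v → vert R u ≡ true → vert R v ≡ true → Reach R u v

sameEdge : ∀ {n} → Fin n → Fin n → Fin n → Fin n → Bool
sameEdge a b u v = (⌊ u ≟ a ⌋ ∧ ⌊ v ≟ b ⌋) ∨ (⌊ u ≟ b ⌋ ∧ ⌊ v ≟ a ⌋)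

removeEdge : ∀ {n} → RawGraph n → Fin n → Fin n → RawGraph n
removeEdge R a b = mkRaw (vert R) (λ u v → adj R u v ∧ not (sameEdge a b u v))

-- ab is a bridge: an edge whose removal disconnects its endpoints
-- (equivalently, increases the number of components)
IsBridge : ∀ {n} → RawGraph n → Fin n → Fin n → Set
IsBridge R a b = adj R a b ≡ true × ¬ Reach (removeEdge R a b) a b

Bridgeless : ∀ {n} → RawGraph n → Set
Bridgeless R = ∀ a b → ¬ IsBridge R a b

deleteAdd : ∀ {n} → RawGraph n → (Fin n → Bool) → Fin n → Fin n → RawGraph n
deleteAdd R V0 a b = mkRaw V' (λ u v → (adj R u v ∧ V' u ∧ V' v) ∨ sameEdge a b u v)
  where
  V' : _ → Bool
  V' v = vert R v ∧ not (V0 v)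

HasCubicComponent : ∀ {n} → RawGraph n → Set
HasCubicComponent R = ∃[ v ] (vert R v ≡ true × (∀ w → Reach R v w → deg R w ≡ 3))

InN : ∀ {n} → Graph n → (Fin n → Bool) → Fin n → Set
InN G V0 v = V G v ≡ true × V0 v ≡ false × ∃[ u ] (V0 u ≡ true × E G v u ≡ true)

ComponentsNot2 : ∀ {n} → RawGraph n → Set
ComponentsNot2 R = ∀ v → vert R v ≡ true →
  (∀ w → Reach R v w → w ≡ v)
  ⊎ (∃[ x ] ∃[ y ] ∃[ z ] (Reach R v x × Reach R v y × Reach R v z
        × ¬ x ≡ y × ¬ y ≡ z × ¬ x ≡ z))

module Submission where

-- Deleting V0 costs every vertex of N a neighbour, so in G − V0 + ab the only vertices of N
-- that can have degree 3 are a and b; and every component of G − V0 meets N because G is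
-- connected. So a cubic component of G − V0 + ab contains a, and no vertex of N other than
-- a and b is reachable from a in G − V0. Moreover a then has a single neighbour u₀ in V0,
-- and if b were not reachable from a in G − V0, the edge a u₀ would be a bridge of G.
-- Since the component of ab in (N, E*) has a third vertex, some edge of E* joins a vertex
-- of {a, b}, say a, to some x ∉ {a, b}. If x is reachable from a in G − V0, adding ab
-- creates no cubic component; otherwise ax is not an edge of G, and adding ax creates none.

open import Defs
open import Data.Nat using (ℕ; zero; suc; _+_; _≤_; _<_; z≤n; s≤s)
open import Data.Nat.Properties
  using (module ≤-Reasoning; ≤-trans; ≤-reflexive; ≤-pred; <⇒≢; <⇒≱; +-suc; +-comm; +-monoʳ-≤)
open import Data.Bool using (Bool; true; false; _∧_; _∨_; not)
import Data.Bool as Bool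
open import Data.Bool.Properties using (¬-not)
open import Data.Fin using (Fin; _≟_)
open import Data.Fin.Properties using (any?)
open import Data.Fin.Subset using (Subset; inside; outside; _∈_; _⊆_; _∪_; ⁅_⁆; ∣_∣)
open import Data.Fin.Subset.Properties
  using (p⊆q⇒∣p∣≤∣q∣; p⊂q⇒∣p∣<∣q∣; ∣p∣≤n; ∣p∣≤∣x∷p∣; ∣⁅x⁆∣≡1; x∈⁅x⁆; x∈⁅y⁆⇒x≡y
        ; x∈p∪q⁺)
open import Data.Vec using ([]; _∷_; tabulate)
open import Data.Vec.Properties using (lookup∘tabulate; []=⇒lookup; lookup⇒[]=)
open import Data.Product using (_×_; ∃-syntax; _,_; proj₁; proj₂)
open import Data.Sum using (_⊎_; inj₁; inj₂; [_,_]′; swap)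
open import Data.Empty using (⊥; ⊥-elim)
open import Relation.Nullary using (¬_; Dec; yes; no; ⌊_⌋; contradiction; ¬?; _×-dec_; _⊎-dec_)
open import Relation.Nullary.Decidable using (map′; decidable-stable)
open import Relation.Unary using (Pred; Decidable)
open import Relation.Binary.PropositionalEquality using (_≡_; refl; trans; cong; subst) renaming (sym to ≡-sym)
open import Function.Base using (_∘_)
open import Function.Bundles using (_⇔_; Equivalence)

∧-true⁻ : ∀ {x y} → x ∧ y ≡ true → x ≡ true × y ≡ true
∧-true⁻ {true} e = refl , e

∧-true⁺ : ∀ {x y} → x ≡ true → y ≡ true → x ∧ y ≡ true
∧-true⁺ refl refl = refl

∨-true⁻ : ∀ {x y} → x ∨ y ≡ true → x ≡ true ⊎ y ≡ true
∨-true⁻ {true} _ = inj₁ refl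
∨-true⁻ {false} e = inj₂ e

∨-trueˡ : ∀ {x y} → x ≡ true → x ∨ y ≡ true
∨-trueˡ refl = refl

∨-trueʳ : ∀ x {y} → y ≡ true → x ∨ y ≡ true
∨-trueʳ true _ = refl
∨-trueʳ false e = e

⌊⌋-true⁻ : ∀ {p} {A : Set p} (d : Dec A) → ⌊ d ⌋ ≡ true → A
⌊⌋-true⁻ (yes a) _ = a

⌊⌋-true⁺ : ∀ {p} {A : Set p} (d : Dec A) → A → ⌊ d ⌋ ≡ true
⌊⌋-true⁺ (yes _) _ = refl
⌊⌋-true⁺ (no ¬a) a = contradiction a ¬a

sameEdge⁻ : ∀ {n} {a b u v : Fin n} → sameEdge a b u v ≡ true → (u ≡ a × v ≡ b) ⊎ (u ≡ b × v ≡ a)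
sameEdge⁻ {a = a} {b} {u} {v} e with ∨-true⁻ {⌊ u ≟ a ⌋ ∧ ⌊ v ≟ b ⌋} e
... | inj₁ p = let ua , vb = ∧-true⁻ p in inj₁ (⌊⌋-true⁻ (u ≟ a) ua , ⌊⌋-true⁻ (v ≟ b) vb)
... | inj₂ p = let ub , va = ∧-true⁻ p in inj₂ (⌊⌋-true⁻ (u ≟ b) ub , ⌊⌋-true⁻ (v ≟ a) va)

sameEdge-refl : ∀ {n} (a b : Fin n) → sameEdge a b a b ≡ true
sameEdge-refl a b = ∨-trueˡ (∧-true⁺ (⌊⌋-true⁺ (a ≟ a) refl) (⌊⌋-true⁺ (b ≟ b) refl))

sameEdge-swap : ∀ {n} (a b : Fin n) → sameEdge a b b a ≡ true
sameEdge-swap a b = ∨-trueʳ (⌊ b ≟ a ⌋ ∧ ⌊ a ≟ b ⌋) (∧-true⁺ (⌊⌋-true⁺ (b ≟ b) refl) (⌊⌋-true⁺ (a ≟ a) refl))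

_⊆ᵇ_ : ∀ {n} → (Fin n → Bool) → (Fin n → Bool) → Set
f ⊆ᵇ g = ∀ i → f i ≡ true → g i ≡ true

∈-tabulate⁺ : ∀ {n} {f : Fin n → Bool} {i} → f i ≡ true → i ∈ tabulate f
∈-tabulate⁺ {f = f} {i} e = lookup⇒[]= i (tabulate f) (trans (lookup∘tabulate f i) e)

∈-tabulate⁻ : ∀ {n} {f : Fin n → Bool} {i} → i ∈ tabulate f → f i ≡ true
∈-tabulate⁻ {f = f} {i} p = trans (≡-sym (lookup∘tabulate f i)) ([]=⇒lookup p)

tabulate-mono : ∀ {n} {f g : Fin n → Bool} → f ⊆ᵇ g → tabulate f ⊆ tabulate g
tabulate-mono f⊆g {i} p = ∈-tabulate⁺ (f⊆g i (∈-tabulate⁻ p))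

∣p∪q∣≤∣p∣+∣q∣ : ∀ {n} (p q : Subset n) → ∣ p ∪ q ∣ ≤ ∣ p ∣ + ∣ q ∣
∣p∪q∣≤∣p∣+∣q∣ [] [] = z≤n
∣p∪q∣≤∣p∣+∣q∣ (outside ∷ p) (outside ∷ q) = ∣p∪q∣≤∣p∣+∣q∣ p q
∣p∪q∣≤∣p∣+∣q∣ (outside ∷ p) (inside ∷ q) =
  ≤-trans (s≤s (∣p∪q∣≤∣p∣+∣q∣ p q)) (≤-reflexive (≡-sym (+-suc ∣ p ∣ ∣ q ∣)))
∣p∪q∣≤∣p∣+∣q∣ (inside ∷ p) (s ∷ q) =
  s≤s (≤-trans (∣p∪q∣≤∣p∣+∣q∣ p q) (+-monoʳ-≤ ∣ p ∣ (∣p∣≤∣x∷p∣ s q)))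

∣tabulate∣-mono : ∀ {n} {f g : Fin n → Bool} → f ⊆ᵇ g → ∣ tabulate f ∣ ≤ ∣ tabulate g ∣
∣tabulate∣-mono f⊆g = p⊆q⇒∣p∣≤∣q∣ (tabulate-mono f⊆g)

∣tabulate∣-strictMono : ∀ {n} {f g : Fin n → Bool} → f ⊆ᵇ g → ∀ {x} → g x ≡ true → ¬ f x ≡ true
  → ∣ tabulate f ∣ < ∣ tabulate g ∣
∣tabulate∣-strictMono f⊆g {x} gx ¬fx =
  p⊂q⇒∣p∣<∣q∣ (tabulate-mono f⊆g , x , ∈-tabulate⁺ gx , λ x∈f → ¬fx (∈-tabulate⁻ x∈f))

∣tabulate∣-strictMono₂ : ∀ {n} {f g : Fin n → Bool} → f ⊆ᵇ g → ∀ {x y} → ¬ x ≡ y → g x ≡ true → g y ≡ true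
  → ¬ f x ≡ true → ¬ f y ≡ true → 2 + ∣ tabulate f ∣ ≤ ∣ tabulate g ∣
∣tabulate∣-strictMono₂ {f = f} {g} f⊆g {x} {y} x≢y gx gy ¬fx ¬fy =
  ≤-trans (s≤s (∣tabulate∣-strictMono {g = f+x} (λ _ → ∨-trueˡ) f+x[x] ¬fx))
          (∣tabulate∣-strictMono f+x⊆g gy ¬f+x[y])
  where
    f+x : Fin _ → Bool
    f+x i = f i ∨ ⌊ i ≟ x ⌋
    f+x[x] : f+x x ≡ true
    f+x[x] = ∨-trueʳ (f x) (⌊⌋-true⁺ (x ≟ x) refl)
    f+x⊆g : f+x ⊆ᵇ g
    f+x⊆g i e with ∨-true⁻ {f i} e
    ... | inj₁ fi = f⊆g i fi
    ... | inj₂ i≡x = subst (λ j → g j ≡ true) (≡-sym (⌊⌋-true⁻ (i ≟ x) i≡x)) gx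
    ¬f+x[y] : ¬ f+x y ≡ true
    ¬f+x[y] e with ∨-true⁻ {f y} e
    ... | inj₁ fy = ¬fy fy
    ... | inj₂ y≡x = x≢y (≡-sym (⌊⌋-true⁻ (y ≟ x) y≡x))

∣tabulate∣≤1+ : ∀ {n} {f g : Fin n → Bool} {x} → (∀ i → g i ≡ true → f i ≡ true ⊎ i ≡ x)
  → ∣ tabulate g ∣ ≤ suc ∣ tabulate f ∣
∣tabulate∣≤1+ {f = f} {g} {x} g⊆f+x = begin
  ∣ tabulate g ∣               ≤⟨ p⊆q⇒∣p∣≤∣q∣ g⊆f∪x ⟩
  ∣ tabulate f ∪ ⁅ x ⁆ ∣       ≤⟨ ∣p∪q∣≤∣p∣+∣q∣ (tabulate f) ⁅ x ⁆ ⟩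
  ∣ tabulate f ∣ + ∣ ⁅ x ⁆ ∣   ≡⟨ cong (∣ tabulate f ∣ +_) (∣⁅x⁆∣≡1 x) ⟩
  ∣ tabulate f ∣ + 1           ≡⟨ +-comm ∣ tabulate f ∣ 1 ⟩
  suc ∣ tabulate f ∣           ∎
  where
    open ≤-Reasoning
    g⊆f∪x : tabulate g ⊆ tabulate f ∪ ⁅ x ⁆
    g⊆f∪x {i} p with g⊆f+x i (∈-tabulate⁻ p)
    ... | inj₁ fi = x∈p∪q⁺ (inj₁ (∈-tabulate⁺ fi))
    ... | inj₂ refl = x∈p∪q⁺ (inj₂ (x∈⁅x⁆ i))

∣tabulate∣>0 : ∀ {n} {f : Fin n → Bool} {x} → f x ≡ true → 0 < ∣ tabulate f ∣
∣tabulate∣>0 {f = f} {x} fx = ≤-trans (≤-reflexive (≡-sym (∣⁅x⁆∣≡1 x))) (p⊆q⇒∣p∣≤∣q∣ x⊆f)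
  where
    x⊆f : ⁅ x ⁆ ⊆ tabulate f
    x⊆f {i} p = ∈-tabulate⁺ (subst (λ j → f j ≡ true) (≡-sym (x∈⁅y⁆⇒x≡y x p)) fx)

module _ {n} {R : RawGraph n} where

  reach-snoc : ∀ {u w v} → Reach R u w → adj R w v ≡ true → Reach R u v
  reach-snoc here e = step e here
  reach-snoc (step e r) e′ = step e (reach-snoc r e′)

  reach-trans : ∀ {u w v} → Reach R u w → Reach R w v → Reach R u v
  reach-trans here r = r
  reach-trans (step e r) r′ = step e (reach-trans r r′)

  reach-mono : ∀ {R′ : RawGraph n} → (∀ u v → adj R u v ≡ true → adj R′ u v ≡ true)
    → ∀ {u v} → Reach R u v → Reach R′ u v
  reach-mono R⊆R′ here = here
  reach-mono R⊆R′ (step e r) = step (R⊆R′ _ _ e) (reach-mono R⊆R′ r)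

  reach-exit : ∀ {p} {P : Pred (Fin n) p} → Decidable P → ∀ {u v} → Reach R u v → P u → ¬ P v
    → ∃[ s ] ∃[ t ] (P s × adj R s t ≡ true × ¬ P t)
  reach-exit P? here Pu ¬Pv = contradiction Pu ¬Pv
  reach-exit P? {u} (step {w = w} e r) Pu ¬Pv with P? w
  ... | yes Pw = reach-exit P? r Pw ¬Pv
  ... | no ¬Pw = u , w , Pu , e , ¬Pw

  reach-removeEdge-closed : ∀ {p} (S : Pred (Fin n) p) {x y}
    → (∀ u v → S u → adj R u v ≡ true → S v ⊎ sameEdge x y u v ≡ true)
    → ∀ {u v} → S u → Reach (removeEdge R x y) u v → S v
  reach-removeEdge-closed S closed Su here = Su
  reach-removeEdge-closed S {x} {y} closed {u} Su (step {w = w} e r) with ∧-true⁻ {adj R u w} e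
  ... | uw , ¬xy with closed u w Su uw
  ...   | inj₁ Sw = reach-removeEdge-closed S closed Sw r
  ...   | inj₂ xy = contradiction (trans (≡-sym (cong not xy)) ¬xy) λ ()

-- Ball k is the set of vertices at distance at most k from u; it stops growing
-- after at most n rounds because it never exceeds n vertices.
module Ball {n} (R : RawGraph n) (u : Fin n) where

  ball : ℕ → Fin n → Bool
  ball zero v = ⌊ v ≟ u ⌋
  ball (suc k) v = ball k v ∨ ⌊ any? (λ w → ball k w ∧ adj R w v Bool.≟ true) ⌋

  ball-sound : ∀ k {v} → ball k v ≡ true → Reach R u v
  ball-sound zero {v} e = subst (Reach R u) (≡-sym (⌊⌋-true⁻ (v ≟ u) e)) here
  ball-sound (suc k) {v} e with ∨-true⁻ {ball k v} e
  ... | inj₁ p = ball-sound k p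
  ... | inj₂ p with ⌊⌋-true⁻ (any? _) p
  ...   | w , q = let kw , wv = ∧-true⁻ q in reach-snoc (ball-sound k kw) wv

  ball-centre : ∀ k → ball k u ≡ true
  ball-centre zero = ⌊⌋-true⁺ (u ≟ u) refl
  ball-centre (suc k) = ∨-trueˡ (ball-centre k)

  ball-step : ∀ k {w v} → ball k w ≡ true → adj R w v ≡ true → ball (suc k) v ≡ true
  ball-step k {w} {v} kw wv = ∨-trueʳ (ball k v) (⌊⌋-true⁺ (any? _) (w , ∧-true⁺ kw wv))

  Stable : ℕ → Set
  Stable k = ball (suc k) ⊆ᵇ ball k

  stable-suc : ∀ k → Stable k → Stable (suc k)
  stable-suc k st v e with ∨-true⁻ {ball (suc k) v} e
  ... | inj₁ p = p
  ... | inj₂ p with ⌊⌋-true⁻ (any? _) p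
  ...   | w , q = let kw , wv = ∧-true⁻ q in ball-step k (st w kw) wv

  stable-or-new : ∀ k → Stable k ⊎ ∃[ v ] (ball (suc k) v ≡ true × ¬ ball k v ≡ true)
  stable-or-new k with any? (λ v → (ball (suc k) v Bool.≟ true) ×-dec (¬? (ball k v Bool.≟ true)))
  ... | yes new = inj₂ new
  ... | no ¬new = inj₁ λ v e → decidable-stable (ball k v Bool.≟ true) (λ ¬kv → ¬new (v , e , ¬kv))

  stable-or-grows : ∀ k → Stable k ⊎ k < ∣ tabulate (ball k) ∣
  stable-or-grows zero = inj₂ (∣tabulate∣>0 {f = ball zero} (ball-centre zero))
  stable-or-grows (suc k) with stable-or-grows k | stable-or-new k
  ... | inj₁ st | _ = inj₁ (stable-suc k st)
  ... | inj₂ _ | inj₁ st = inj₁ (stable-suc k st)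
  ... | inj₂ k<∣k∣ | inj₂ (v , kv , ¬kv) =
    inj₂ (≤-trans (s≤s k<∣k∣)
                  (∣tabulate∣-strictMono {f = ball k} {g = ball (suc k)} (λ _ → ∨-trueˡ) kv ¬kv))

  stable : Stable n
  stable with stable-or-grows n
  ... | inj₁ st = st
  ... | inj₂ n<∣n∣ = contradiction (∣p∣≤n (tabulate (ball n))) (<⇒≱ n<∣n∣)

  ball-complete : ∀ {w v} → ball n w ≡ true → Reach R w v → ball n v ≡ true
  ball-complete nw here = nw
  ball-complete nw (step e r) = ball-complete (stable _ (ball-step n nw e)) r

reachable? : ∀ {n} (R : RawGraph n) u v → Dec (Reach R u v)
reachable? {n} R u v = map′ (ball-sound n) (ball-complete (ball-centre n)) (ball n v Bool.≟ true)
  where open Ball R u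

OneOf : ∀ {n} → Fin n → Fin n → Pred (Fin n) _
OneOf a b t = t ≡ a ⊎ t ≡ b

oneOf? : ∀ {n} (a b : Fin n) → Decidable (OneOf a b)
oneOf? a b t = (t ≟ a) ⊎-dec (t ≟ b)

three-distinct⇒outside : ∀ {n p} {P : Pred (Fin n) p} (a b : Fin n) {x y z} → P x → P y → P z
  → ¬ x ≡ y → ¬ y ≡ z → ¬ x ≡ z → ∃[ t ] (P t × ¬ OneOf a b t)
three-distinct⇒outside a b {x} {y} {z} Px Py Pz x≢y y≢z x≢z
  with oneOf? a b x | oneOf? a b y | oneOf? a b z
... | no x∉ | _ | _ = x , Px , x∉
... | yes _ | no y∉ | _ = y , Py , y∉
... | yes _ | yes _ | no z∉ = z , Pz , z∉
... | yes x∈ | yes y∈ | yes z∈ = ⊥-elim (pigeonhole x∈ y∈ z∈)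
  where
    pigeonhole : OneOf a b x → OneOf a b y → OneOf a b z → ⊥
    pigeonhole (inj₁ refl) (inj₁ refl) _ = x≢y refl
    pigeonhole (inj₂ refl) (inj₂ refl) _ = x≢y refl
    pigeonhole (inj₁ refl) _ (inj₁ refl) = x≢z refl
    pigeonhole (inj₂ refl) _ (inj₂ refl) = x≢z refl
    pigeonhole _ (inj₁ refl) (inj₁ refl) = y≢z refl
    pigeonhole _ (inj₂ refl) (inj₂ refl) = y≢z refl

edge-leaving-pair : ∀ {n} (H : Graph n) → ComponentsNot2 (raw H) → ∀ {a b} → E H a b ≡ true
  → ∃[ s ] ∃[ x ] (OneOf a b s × E H s x ≡ true × ¬ OneOf a b x)
edge-leaving-pair H not2 {a} {b} ab∈H with not2 a (adj-vert H a b ab∈H)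
... | inj₁ singleton = contradiction (trans (≡-sym loop) (irrefl H a)) λ ()
  where
    loop : E H a a ≡ true
    loop = subst (λ v → E H a v ≡ true) (singleton b (step ab∈H here)) ab∈H
... | inj₂ (x , y , z , ax , ay , az , x≢y , y≢z , x≢z)
  with three-distinct⇒outside a b ax ay az x≢y y≢z x≢z
...   | t , at , t∉ = reach-exit (oneOf? a b) at (inj₁ refl) t∉

module Deletion {n} (G : Graph n) (V0 : Fin n → Bool) (subcubic : Subcubic (raw G)) where

  private
    R : RawGraph n
    R = raw G

  V′ : Fin n → Bool
  V′ v = vert R v ∧ not (V0 v)

  G−V0 : RawGraph n
  G−V0 = mkRaw V′ (λ u v → adj R u v ∧ V′ u ∧ V′ v)

  N : Fin n → Set
  N = InN G V0

  V′⁺ : ∀ {v} → V G v ≡ true → V0 v ≡ false → V′ v ≡ true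
  V′⁺ vv v∉V0 rewrite vv | v∉V0 = refl

  V′⁻ : ∀ {v} → V′ v ≡ true → V G v ≡ true × V0 v ≡ false
  V′⁻ {v} e with vert R v | V0 v
  ... | true | false = refl , refl

  V0⇒¬V′ : ∀ {v} → V0 v ≡ true → ¬ V′ v ≡ true
  V0⇒¬V′ v∈V0 e = contradiction (trans (≡-sym v∈V0) (proj₂ (V′⁻ e))) λ ()

  N⇒V′ : ∀ {w} → N w → V′ w ≡ true
  N⇒V′ (vw , w∉V0 , _) = V′⁺ vw w∉V0

  adj-vertʳ : ∀ {u v} → adj R u v ≡ true → V G v ≡ true
  adj-vertʳ {u} {v} uv = adj-vert G v u (trans (Graph.sym G v u) uv)

  G−V0-adj⁺ : ∀ {u v} → adj R u v ≡ true → V′ u ≡ true → V′ v ≡ true → adj G−V0 u v ≡ true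
  G−V0-adj⁺ uv u′ v′ = ∧-true⁺ uv (∧-true⁺ u′ v′)

  G−V0-adj⁻ : ∀ {u v} → adj G−V0 u v ≡ true → adj R u v ≡ true × V′ u ≡ true × V′ v ≡ true
  G−V0-adj⁻ {u} e with ∧-true⁻ {adj R u _} e
  ... | uv , rest = uv , ∧-true⁻ {V′ u} rest

  G−V0⊆G : ∀ w → adj G−V0 w ⊆ᵇ adj R w
  G−V0⊆G w t = proj₁ ∘ G−V0-adj⁻

  G−V0-reach-V′ : ∀ {u v} → V′ u ≡ true → Reach G−V0 u v → V′ v ≡ true
  G−V0-reach-V′ u′ here = u′
  G−V0-reach-V′ u′ (step e r) = G−V0-reach-V′ (proj₂ (proj₂ (G−V0-adj⁻ e))) r

  deg-G−V0≤2 : ∀ {w} → N w → deg G−V0 w ≤ 2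
  deg-G−V0≤2 {w} (vw , _ , u , u∈V0 , wu) =
    ≤-pred (≤-trans (∣tabulate∣-strictMono (G−V0⊆G w) wu ¬G−V0[wu]) (subcubic w vw))
    where
      ¬G−V0[wu] : ¬ adj G−V0 w u ≡ true
      ¬G−V0[wu] e = V0⇒¬V′ u∈V0 (proj₂ (proj₂ (G−V0-adj⁻ e)))

  deg-G−V0≤1 : ∀ {w u u′} → V G w ≡ true → ¬ u ≡ u′ → V0 u ≡ true → V0 u′ ≡ true
    → adj R w u ≡ true → adj R w u′ ≡ true → deg G−V0 w ≤ 1
  deg-G−V0≤1 {w} vw u≢u′ u∈V0 u′∈V0 wu wu′ =
    ≤-pred (≤-pred (≤-trans two-missing (subcubic w vw)))
    where
      ¬G−V0 : ∀ {t} → V0 t ≡ true → ¬ adj G−V0 w t ≡ true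
      ¬G−V0 t∈V0 e = V0⇒¬V′ t∈V0 (proj₂ (proj₂ (G−V0-adj⁻ e)))
      two-missing : 2 + deg G−V0 w ≤ deg R w
      two-missing = ∣tabulate∣-strictMono₂ (G−V0⊆G w) u≢u′ wu wu′ (¬G−V0 u∈V0) (¬G−V0 u′∈V0)

  -- The last vertex before the walk first enters V0 lies in N.
  reach-N : ∀ {v t} → Reach R v t → V′ v ≡ true → V0 t ≡ true → ∃[ w ] (N w × Reach G−V0 v w)
  reach-N here v′ v∈V0 = contradiction v′ (V0⇒¬V′ v∈V0)
  reach-N {v} (step {w = w} vw r) v′ t∈V0 with V0 w in e
  ... | true = v , (proj₁ (V′⁻ v′) , proj₂ (V′⁻ v′) , w , e , vw) , here
  ... | false with reach-N r w′ t∈V0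
    where
      w′ : V′ w ≡ true
      w′ = V′⁺ (adj-vertʳ vw) e
  ...   | x , Nx , wx = x , Nx , step (G−V0-adj⁺ vw v′ (V′⁺ (adj-vertʳ vw) e)) wx

  module Adding (a b : Fin n) where

    D : RawGraph n
    D = deleteAdd R V0 a b

    D-adj⁻ : ∀ {u t} → adj D u t ≡ true
      → adj G−V0 u t ≡ true ⊎ (u ≡ a × t ≡ b) ⊎ (u ≡ b × t ≡ a)
    D-adj⁻ {u} {t} e with ∨-true⁻ {adj G−V0 u t} e
    ... | inj₁ ut = inj₁ ut
    ... | inj₂ ab = inj₂ (sameEdge⁻ ab)

    G−V0⊆D : ∀ u t → adj G−V0 u t ≡ true → adj D u t ≡ true
    G−V0⊆D u t = ∨-trueˡ

    ba∈D : adj D b a ≡ true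
    ba∈D = ∨-trueʳ (adj G−V0 b a) (sameEdge-swap a b)

    deg-D[a]≤1+deg-G−V0 : deg D a ≤ suc (deg G−V0 a)
    deg-D[a]≤1+deg-G−V0 = ∣tabulate∣≤1+ {f = adj G−V0 a} {g = adj D a} λ t e → new-b (D-adj⁻ e)
      where
        new-b : ∀ {t} → adj G−V0 a t ≡ true ⊎ (a ≡ a × t ≡ b) ⊎ (a ≡ b × t ≡ a)
          → adj G−V0 a t ≡ true ⊎ t ≡ b
        new-b (inj₁ at) = inj₁ at
        new-b (inj₂ (inj₁ (_ , t≡b))) = inj₂ t≡b
        new-b (inj₂ (inj₂ (a≡b , t≡a))) = inj₂ (trans t≡a a≡b)

    deg-D≤1+deg-G−V0 : ∀ {w} → ¬ w ≡ a → deg D w ≤ suc (deg G−V0 w)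
    deg-D≤1+deg-G−V0 {w} w≢a = ∣tabulate∣≤1+ {f = adj G−V0 w} {g = adj D w} λ t e → new-a (D-adj⁻ e)
      where
        new-a : ∀ {t} → adj G−V0 w t ≡ true ⊎ (w ≡ a × t ≡ b) ⊎ (w ≡ b × t ≡ a)
          → adj G−V0 w t ≡ true ⊎ t ≡ a
        new-a (inj₁ wt) = inj₁ wt
        new-a (inj₂ (inj₁ (w≡a , _))) = contradiction w≡a w≢a
        new-a (inj₂ (inj₂ (_ , t≡a))) = inj₂ t≡a

    deg-D≤deg-G−V0 : ∀ {w} → ¬ w ≡ a → ¬ w ≡ b → deg D w ≤ deg G−V0 w
    deg-D≤deg-G−V0 {w} w≢a w≢b =
      ∣tabulate∣-mono {f = adj D w} {g = adj G−V0 w} λ t e → old-edge (D-adj⁻ e)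
      where
        old-edge : ∀ {t} → adj G−V0 w t ≡ true ⊎ (w ≡ a × t ≡ b) ⊎ (w ≡ b × t ≡ a)
          → adj G−V0 w t ≡ true
        old-edge (inj₁ wt) = wt
        old-edge (inj₂ (inj₁ (w≡a , _))) = contradiction w≡a w≢a
        old-edge (inj₂ (inj₂ (w≡b , _))) = contradiction w≡b w≢b

    D-subcubic : N a → N b → Subcubic D
    D-subcubic Na Nb w w′ = by-cases (w ≟ a) (w ≟ b)
      where
        by-cases : Dec (w ≡ a) → Dec (w ≡ b) → deg D w ≤ 3
        by-cases (yes w≡a) _ =
          subst (λ v → deg D v ≤ 3) (≡-sym w≡a) (≤-trans deg-D[a]≤1+deg-G−V0 (s≤s (deg-G−V0≤2 Na)))
        by-cases (no w≢a) (yes w≡b) =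
          ≤-trans (deg-D≤1+deg-G−V0 w≢a) (s≤s (deg-G−V0≤2 (subst N (≡-sym w≡b) Nb)))
        by-cases (no w≢a) (no w≢b) =
          ≤-trans (deg-D≤deg-G−V0 w≢a w≢b)
                  (≤-trans (∣tabulate∣-mono (G−V0⊆G w)) (subcubic w (proj₁ (V′⁻ w′))))

    N-deg-D≢3 : ∀ {w} → N w → ¬ w ≡ a → ¬ w ≡ b → ¬ deg D w ≡ 3
    N-deg-D≢3 Nw w≢a w≢b = <⇒≢ (s≤s (≤-trans (deg-D≤deg-G−V0 w≢a w≢b) (deg-G−V0≤2 Nw)))

    module CubicComponent (connected : Connected R) (Na : N a) (Nb : N b)
                          (cubic : HasCubicComponent D) where

      u₀ : Fin n
      u₀ = proj₁ (proj₂ (proj₂ Na))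

      u₀∈V0 : V0 u₀ ≡ true
      u₀∈V0 = proj₁ (proj₂ (proj₂ (proj₂ Na)))

      au₀ : adj R a u₀ ≡ true
      au₀ = proj₂ (proj₂ (proj₂ (proj₂ Na)))

      -- The cubic component contains an N-vertex, and only a and b are cubic in N.
      a-cubic : ∀ {t} → Reach D a t → deg D t ≡ 3
      a-cubic {t} at = all-cubic t (reach-trans v₀a at)
        where
          v₀ = proj₁ cubic
          v₀′ = proj₁ (proj₂ cubic)
          all-cubic = proj₂ (proj₂ cubic)
          v₀a : Reach D v₀ a
          v₀a with reach-N (connected v₀ u₀ (proj₁ (V′⁻ v₀′)) (adj-vertʳ au₀)) v₀′ u₀∈V0
          ... | w , Nw , v₀w with reach-mono G−V0⊆D v₀w | w ≟ a | w ≟ b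
          ...   | v₀w′ | yes refl | _ = v₀w′
          ...   | v₀w′ | no _ | yes refl = reach-snoc v₀w′ ba∈D
          ...   | v₀w′ | no w≢a | no w≢b = contradiction (all-cubic w v₀w′) (N-deg-D≢3 Nw w≢a w≢b)

      N-reach⊆ab : ∀ {w} → N w → Reach G−V0 a w → OneOf a b w
      N-reach⊆ab {w} Nw aw with oneOf? a b w
      ... | yes w∈ab = w∈ab
      ... | no w∉ab =
        contradiction (a-cubic (reach-mono G−V0⊆D aw)) (N-deg-D≢3 Nw (w∉ab ∘ inj₁) (w∉ab ∘ inj₂))

      V0-neighbour-unique : ∀ {u} → V0 u ≡ true → adj R a u ≡ true → u ≡ u₀
      V0-neighbour-unique {u} u∈V0 au with u ≟ u₀
      ... | yes u≡u₀ = u≡u₀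
      ... | no u≢u₀ = contradiction (a-cubic here) (<⇒≢ (s≤s deg-D[a]≤2))
        where
          deg-D[a]≤2 : deg D a ≤ 2
          deg-D[a]≤2 = ≤-trans deg-D[a]≤1+deg-G−V0 (s≤s (deg-G−V0≤1 (proj₁ Na) u≢u₀ u∈V0 u₀∈V0 au au₀))

      -- Otherwise the component of a in G − V0 is left only through the edge a u₀.
      reach-ab : Bridgeless R → Reach G−V0 a b
      reach-ab bridgeless with reachable? G−V0 a b
      ... | yes ab = ab
      ... | no ¬ab = ⊥-elim (bridgeless a u₀ (au₀ , ¬au₀))
        where
          closed : ∀ u v → Reach G−V0 a u → adj R u v ≡ true
            → Reach G−V0 a v ⊎ sameEdge a u₀ u v ≡ true
          closed u v au uv with G−V0-reach-V′ (N⇒V′ Na) au | V0 v in v∈V0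
          ... | u′ | false = inj₁ (reach-snoc au (G−V0-adj⁺ uv u′ (V′⁺ (adj-vertʳ uv) v∈V0)))
          ... | u′ | true with N-reach⊆ab (proj₁ (V′⁻ u′) , proj₂ (V′⁻ u′) , v , v∈V0 , uv) au
          ...   | inj₂ refl = contradiction au ¬ab
          ...   | inj₁ refl =
            inj₂ (subst (λ x → sameEdge a u₀ a x ≡ true) (≡-sym (V0-neighbour-unique v∈V0 uv))
                        (sameEdge-refl a u₀))
          ¬au₀ : ¬ Reach (removeEdge R a u₀) a u₀
          ¬au₀ r =
            V0⇒¬V′ u₀∈V0 (G−V0-reach-V′ (N⇒V′ Na) (reach-removeEdge-closed (Reach G−V0 a) closed here r))

  Good : Fin n → Fin n → Set
  Good a b = E G a b ≡ false × Subcubic (Adding.D a b) × ¬ HasCubicComponent (Adding.D a b)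

  good-edge : Connected R → Bridgeless R → ∀ {a b x} → N a → N b → N x
    → E G a b ≡ false → ¬ OneOf a b x → Good a b ⊎ Good a x
  good-edge connected bridgeless {a} {b} {x} Na Nb Nx ab∉G x∉ab with reachable? G−V0 a x
  ... | yes ax =
    inj₁ (ab∉G , D-subcubic a b Na Nb , λ cubic → x∉ab (N-reach⊆ab a b connected Na Nb cubic Nx ax))
    where open Adding
          open CubicComponent
  ... | no ¬ax =
    inj₂ (ax∉G , D-subcubic a x Na Nx , λ cubic → ¬ax (reach-ab a x connected Na Nx cubic bridgeless))
    where open Adding
          open CubicComponent
          ax∉G : E G a x ≡ false
          ax∉G = ¬-not λ ax∈G → ¬ax (step (G−V0-adj⁺ ax∈G (N⇒V′ Na) (N⇒V′ Nx)) here)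

lemma2p1 : ∀ {n} (G : Graph n) → Bridgeless (raw G) → Connected (raw G) → Subcubic (raw G)
    → (V0 : Fin n → Bool) → (∀ v → V0 v ≡ true → V G v ≡ true)
    → (H : Graph n) → (∀ v → (V H v ≡ true) ⇔ InN G V0 v)
    → ComponentsNot2 (raw H)
    → (∃[ a ] ∃[ b ] (E H a b ≡ true × E G a b ≡ false))
    → ∃[ a ] ∃[ b ] (E H a b ≡ true × E G a b ≡ false
        × Subcubic (deleteAdd (raw G) V0 a b)
        × ¬ HasCubicComponent (deleteAdd (raw G) V0 a b))
lemma2p1 G bridgeless connected subcubic V0 _ H H⇔N not2 (a , b , ab∈H , ab∉G) =
  leave (edge-leaving-pair H not2 ab∈H)
  where
    open Deletion G V0 subcubic

    N-of-H : ∀ {u v} → E H u v ≡ true → N u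
    N-of-H {u} {v} uv = Equivalence.to (H⇔N u) (adj-vert H u v uv)

    H-sym : ∀ {u v} → E H u v ≡ true → E H v u ≡ true
    H-sym {u} {v} uv = trans (Graph.sym H v u) uv

    choose : ∀ {a b x} → E H a b ≡ true → E G a b ≡ false → E H a x ≡ true → ¬ OneOf a b x
      → ∃[ p ] ∃[ q ] (E H p q ≡ true × Good p q)
    choose {a} {b} {x} ab∈H ab∉G ax∈H x∉ab =
      [ (λ good → a , b , ab∈H , good) , (λ good → a , x , ax∈H , good) ]′
        (good-edge connected bridgeless (N-of-H ab∈H) (N-of-H (H-sym ab∈H)) (N-of-H (H-sym ax∈H)) ab∉G x∉ab)

    leave : ∃[ s ] ∃[ x ] (OneOf a b s × E H s x ≡ true × ¬ OneOf a b x)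
      → ∃[ p ] ∃[ q ] (E H p q ≡ true × Good p q)
    leave (_ , _ , inj₁ refl , ax∈H , x∉ab) = choose ab∈H ab∉G ax∈H x∉ab
    leave (_ , _ , inj₂ refl , bx∈H , x∉ab) =
      choose (H-sym ab∈H) (trans (Graph.sym G b a) ab∉G) bx∈H (x∉ab ∘ swap)
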